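{- Let $\mathbb{S}$ and $\mathbb{T}$ be algebraic theories such that: (S1) for all $\mathbb S$-terms $s',s''$: if $\emptyset \vdash s'$ and $\Gamma \vdash s' =_{\mathbb{S}} s''$ then $\emptyset \vdash s''$; (S2) for every $\mathbb S$-term $s'$ and variable $x$: if $\Gamma\vdash s' =_{\mathbb{S}} x$ then $\{x\}\vdash s'$; (S4) for every $\mathbb{S}$-term $s'$ with at least one variable there is a substitution $f$ from $\mathrm{var}(s')$ to $\mathbb{S}$-terms such that for every $x\in\mathrm{var}(s')$, $s'[f(y)/y\neq x] =_{\mathbb{S}} x$; (T2) for all $\mathbb T$-terms $t',t''$: if $\emptyset \vdash t'$ and $\Gamma \vdash t' =_{\mathbb{T}} t''$ then $\emptyset \vdash t''$; (T3) for every $\mathbb T$-term $t'$ and variable $x$: if $\Gamma \vdash t' =_{\mathbb{T}} x$ then $\{x\}\vdash t'$; (T4) $\mathbb{T}$ has a constant $e_{\mathbb{T}}$. Suppose there are terms $2 \vdash_{\mathbb{S}} s$ and $2\vdash_{\mathbb{T}} t$ and constants $e_s$ of $\mathbb{S}$ and $e_t$ of $\mathbb{T}$ with $s(x,e_s) =_{\mathbb{S}} x =_{\mathbb{S}} s(e_s,x)$ and $t(x,e_t) =_{\mathbb{T}} x =_{\mathbb{T}} t(e_t,x)$. Let $\mathbb{U}$ be a composite theory of $\mathbb{T}$ after $\mathbb{S}$, and let $y_1,y_2,x_0$ be distinct variables. Then there are a $\mathbb{T}$-term $X\vdash t'$ and $\mathbb{S}$-terms $s'_x$ ($x\in X$)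 such that $s(t(y_1,y_2),x_0) =_{\mathbb{U}} t'[s'_x/x]$, for each $x\in\mathrm{var}(t')$ either $s'_x =_{\mathbb{S}} s(y_1,x_0)$ or $s'_x =_{\mathbb{S}} s(y_2,x_0)$, and there are $x$ with $s'_x =_{\mathbb{S}} s(y_1,x_0)$ and $x$ with $s'_x =_{\mathbb{S}} s(y_2,x_0)$. Similarly, there are a $\mathbb{T}$-term $X'\vdash t''$ and $\mathbb{S}$-terms $s''_{x'}$ ($x'\in X'$) such that $s(x_0,t(y_1,y_2)) =_{\mathbb{U}} t''[s''_{x'}/x']$, for each $x'\in\mathrm{var}(t'')$ either $s''_{x'} =_{\mathbb{S}} s(x_0,y_1)$ or $s''_{x'} =_{\mathbb{S}} s(x_0,y_2)$, and there are $x'$ with $s''_{x'} =_{\mathbb{S}} s(x_0,y_1)$ and $x'$ with $s''_{x'} =_{\mathbb{S}} s(x_0,y_2)$.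
   Context: An algebraic theory consists of a signature and equations; $=_{\mathbb T}$ is provable equality. $\mathrm{var}(t)$ is the set of variables of $t$; $Y\vdash t$ means $\mathrm{var}(t)\subseteq Y$; $\Gamma$ is an arbitrary context; a constant is a $0$-ary operation. $s'[f(y)/y\neq x]$ substitutes $f(y)$ for every variable $y\neq x$ of $s'$. For theories $\mathbb{S},\mathbb{T}$: $\mathbb{U}$ contains them if its signature contains both signatures and their equations are provable in $\mathbb{U}$; a separated term is $t[s_x/x]$ (simultaneous substitution) with $t$ a $\mathbb{T}$-term with variables in $X$ and $s_x$ $\mathbb{S}$-terms; separated terms $t[s_x/x]$, $t'[s'_{x'}/x']$ are equal modulo $(\mathbb{T},\mathbb{S})$ if there are $f:X\to Y$, $f':X'\to Y$ and $\mathbb{S}$-terms $\bar s_y$ with $t[f(x)/x]=_{\mathbb T}t'[f'(x')/x']$, $s_x=_{\mathbb S}\bar s_{f(x)}$, $s'_{x'}=_{\mathbb S}\bar s_{f'(x')}$; $\mathbb{U}$ is a composite theory of $\mathbb{T}$ after $\mathbb{S}$ if every $\mathbb U$-term is $\mathbb U$-equal to a separated term and any two separated terms $\mathbb U$-equal to a common term are equal modulo $(\mathbb{T},\mathbb{S})$. -}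

module Defs where

open import Data.Nat using (ℕ; zero; suc; _≟_)
open import Data.Fin using (Fin)
open import Data.Empty using (⊥; ⊥-elim)
open import Data.Product using (Σ; Σ-syntax; ∃; ∃-syntax; _×_; _,_)
open import Data.Sum using (_⊎_)
open import Relation.Binary.PropositionalEquality using (_≡_; _≢_; subst)
open import Relation.Nullary using (¬_; yes; no)

record Signature : Set₁ where
  field
    Op    : Set
    arity : Op → ℕ
open Signature public

data Term (Sg : Signature) : Set where
  var : ℕ → Term Sg
  op  : (o : Op Sg) → (Fin (arity Sg o) → Term Sg) → Term Sg

module _ {Sg : Signature} where

  _[_] : Term Sg → (ℕ → Term Sg) → Term Sg
  var x   [ σ ] = σ x
  op o ts [ σ ] = op o (λ i → ts i [ σ ])

  rename : Term Sg → (ℕ → ℕ) → Term Sg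
  rename t f = t [ (λ x → var (f x)) ]

  data _∈v_ (x : ℕ) : Term Sg → Set where
    here  : x ∈v var x
    there : ∀ {o ts} (i : Fin (arity Sg o)) → x ∈v ts i → x ∈v op o ts

  _⊢ᵥ_ : (ℕ → Set) → Term Sg → Set
  Y ⊢ᵥ t = ∀ x → x ∈v t → Y x

  Closed : Term Sg → Set
  Closed t = ∀ x → ¬ (x ∈v t)

  const : (o : Op Sg) → arity Sg o ≡ 0 → Term Sg
  const o p = op o (λ i → ⊥-elim (fin0 (subst Fin p i)))
    where
      fin0 : Fin 0 → ⊥
      fin0 ()

  Binary : Term Sg → Set
  Binary t = ∀ x → x ∈v t → x ≡ 0 ⊎ x ≡ 1

  pair : Term Sg → Term Sg → ℕ → Term Sg
  pair a b zero          = a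
  pair a b (suc zero)    = b
  pair a b (suc (suc n)) = var (suc (suc n))

  app2 : Term Sg → Term Sg → Term Sg → Term Sg
  app2 t a b = t [ pair a b ]

  subExcept : (ℕ → Term Sg) → ℕ → ℕ → Term Sg
  subExcept f x y with y ≟ x
  ... | yes _ = var y
  ... | no  _ = f y

record Theory : Set₁ where
  field
    sig : Signature
    Ax  : Set
    lhs : Ax → Term sig
    rhs : Ax → Term sig
open Theory public

TTerm : Theory → Set
TTerm 𝕋 = Term (sig 𝕋)

data _⊢_≈_ (𝕋 : Theory) : TTerm 𝕋 → TTerm 𝕋 → Set where
  ≈-refl  : ∀ {u} → 𝕋 ⊢ u ≈ u
  ≈-sym   : ∀ {u v} → 𝕋 ⊢ u ≈ v → 𝕋 ⊢ v ≈ u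
  ≈-trans : ∀ {u v w} → 𝕋 ⊢ u ≈ v → 𝕋 ⊢ v ≈ w → 𝕋 ⊢ u ≈ w
  ≈-cong  : ∀ o {ts us} → (∀ i → 𝕋 ⊢ ts i ≈ us i) → 𝕋 ⊢ op o ts ≈ op o us
  ≈-ax    : ∀ (a : Ax 𝕋) (σ : ℕ → TTerm 𝕋) → 𝕋 ⊢ (lhs 𝕋 a [ σ ]) ≈ (rhs 𝕋 a [ σ ])

record SigIncl (Sg Sg' : Signature) : Set where
  field
    map  : Op Sg → Op Sg'
    pres : ∀ o → arity Sg' (map o) ≡ arity Sg o
    inj  : ∀ {o o'} → map o ≡ map o' → o ≡ o'
open SigIncl public

translate : {Sg Sg' : Signature} → SigIncl Sg Sg' → Term Sg → Term Sg'
translate ι (var x)   = var x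
translate ι (op o ts) = op (map ι o) (λ i → translate ι (ts (subst Fin (pres ι o) i)))

record Contains (𝕊 𝕋 𝕌 : Theory) : Set where
  field
    ιS   : SigIncl (sig 𝕊) (sig 𝕌)
    ιT   : SigIncl (sig 𝕋) (sig 𝕌)
    eqsS : ∀ a → 𝕌 ⊢ translate ιS (lhs 𝕊 a) ≈ translate ιS (rhs 𝕊 a)
    eqsT : ∀ a → 𝕌 ⊢ translate ιT (lhs 𝕋 a) ≈ translate ιT (rhs 𝕋 a)
open Contains public

module _ {𝕊 𝕋 𝕌 : Theory} (c : Contains 𝕊 𝕋 𝕌) where

  sep : TTerm 𝕋 → (ℕ → TTerm 𝕊) → TTerm 𝕌
  sep t s = translate (ιT c) t [ (λ x → translate (ιS c) (s x)) ]

  EqMod : TTerm 𝕋 → (ℕ → TTerm 𝕊) → TTerm 𝕋 → (ℕ → TTerm 𝕊) → Set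
  EqMod t s t' s' =
    Σ[ f ∈ (ℕ → ℕ) ] Σ[ f' ∈ (ℕ → ℕ) ] Σ[ sb ∈ (ℕ → TTerm 𝕊) ]
      (𝕋 ⊢ rename t f ≈ rename t' f')
      × (∀ x → x ∈v t → 𝕊 ⊢ s x ≈ sb (f x))
      × (∀ x' → x' ∈v t' → 𝕊 ⊢ s' x' ≈ sb (f' x'))

  IsComposite : Set
  IsComposite =
    (∀ (u : TTerm 𝕌) → Σ[ t ∈ TTerm 𝕋 ] Σ[ s ∈ (ℕ → TTerm 𝕊) ] (𝕌 ⊢ u ≈ sep t s))
    × (∀ t s t' s' (u : TTerm 𝕌) → 𝕌 ⊢ sep t s ≈ u → 𝕌 ⊢ sep t' s' ≈ u → EqMod t s t' s')

ClosedStable : Theory → Set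
ClosedStable 𝕋 = ∀ (u v : TTerm 𝕋) → Closed u → 𝕋 ⊢ u ≈ v → Closed v

VarStable : Theory → Set
VarStable 𝕋 = ∀ (u : TTerm 𝕋) (x : ℕ) → 𝕋 ⊢ u ≈ var x → (λ y → y ≡ x) ⊢ᵥ u

VarRecover : Theory → Set
VarRecover 𝕋 = ∀ (u : TTerm 𝕋) → (∃[ x ] x ∈v u) →
  Σ[ f ∈ (ℕ → TTerm 𝕋) ] (∀ x → x ∈v u → 𝕋 ⊢ (u [ subExcept f x ]) ≈ var x)

HasConstant : Theory → Set
HasConstant 𝕋 = Σ[ o ∈ Op (sig 𝕋) ] arity (sig 𝕋) o ≡ 0

HasUnit : (𝕋 : Theory) → TTerm 𝕋 → Set
HasUnit 𝕋 t = Σ[ e ∈ Op (sig 𝕋) ] Σ[ p ∈ arity (sig 𝕋) e ≡ 0 ]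
  (∀ x → (𝕋 ⊢ app2 t (var x) (const e p) ≈ var x)
       × (𝕋 ⊢ app2 t (const e p) (var x) ≈ var x))

module _ {𝕊 𝕋 𝕌 : Theory} (c : Contains 𝕊 𝕋 𝕌) where

  SplitsAs : TTerm 𝕌 → TTerm 𝕊 → TTerm 𝕊 → Set
  SplitsAs u a b =
    Σ[ t' ∈ TTerm 𝕋 ] Σ[ s' ∈ (ℕ → TTerm 𝕊) ]
      (𝕌 ⊢ u ≈ sep c t' s')
      × (∀ x → x ∈v t' → (𝕊 ⊢ s' x ≈ a) ⊎ (𝕊 ⊢ s' x ≈ b))
      × (Σ[ x ∈ ℕ ] (x ∈v t') × (𝕊 ⊢ s' x ≈ a))
      × (Σ[ x ∈ ℕ ] (x ∈v t') × (𝕊 ⊢ s' x ≈ b))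

-- Separate u = s(t(y₁,y₂), x₀) as t′[σ]. Substituting the unit eₛ of s for x₀
-- turns u into t(y₁,y₂); by uniqueness of separations (and since 𝕋-equations
-- preserve variables, by (T2) and a constant) every specialised filler σ x is
-- one of the variables y₁, y₂, and both occur. Substituting the unit eₜ of t for y₂
-- turns u into the 𝕊-term s(y₁,x₀). Separating each σ x [y₂ ↦ eₜ] and grafting
-- these into t′ separates s(y₁,x₀) a second way, in which a filler with
-- σ x [x₀ ↦ eₛ] = y₁ stays σ x by (S2); comparing with the trivial separation,
-- (T3) shows that σ x = s(y₁,x₀).
module Submission where

open import Defs
open import Data.Nat using (ℕ; zero; suc; _+_; _≟_)
open import Data.Nat.Properties using (+-suc; +-identityʳ; ≟-diag)
open import Data.Fin using (Fin)
open import Data.Fin.Properties using (any?)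
open import Data.Empty using (⊥-elim)
open import Data.Product using (Σ-syntax; ∃-syntax; _×_; _,_; proj₁; proj₂)
open import Data.Sum using (_⊎_; inj₁; inj₂)
open import Function using (_∘_)
open import Relation.Binary.PropositionalEquality using (_≡_; _≢_; refl; sym; cong; subst)
open import Relation.Nullary using (¬_; Dec; yes; no)

next : ℕ × ℕ → ℕ × ℕ
next (zero  , v) = suc v , zero
next (suc x , v) = x , suc v

unpair : ℕ → ℕ × ℕ
unpair zero    = 0 , 0
unpair (suc m) = next (unpair m)

Enumerated : ℕ × ℕ → Set
Enumerated p = Σ[ m ∈ ℕ ] unpair m ≡ p

enumerated-next : ∀ {p} → Enumerated p → Enumerated (next p)
enumerated-next (m , eq) = suc m , cong next eq

enumerated-antidiagonal : ∀ v x → Enumerated (v + x , 0) → Enumerated (x , v)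
enumerated-antidiagonal zero    x hit = hit
enumerated-antidiagonal (suc v) x hit =
  enumerated-next (enumerated-antidiagonal v (suc x) (subst (Enumerated ∘ (_, 0)) (sym (+-suc v x)) hit))

enumerated-axis : ∀ d → Enumerated (d , 0)
enumerated-axis zero    = 0 , refl
enumerated-axis (suc d) =
  enumerated-next (enumerated-antidiagonal d 0 (subst (Enumerated ∘ (_, 0)) (sym (+-identityʳ d)) (enumerated-axis d)))

unpair-surjective : ∀ x v → Enumerated (x , v)
unpair-surjective x v = enumerated-antidiagonal v x (enumerated-axis (v + x))

⟨_,_⟩ : ℕ → ℕ → ℕ
⟨ x , v ⟩ = proj₁ (unpair-surjective x v)

unpair-⟨,⟩ : ∀ x v → unpair ⟨ x , v ⟩ ≡ (x , v)
unpair-⟨,⟩ x v = proj₂ (unpair-surjective x v)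

module _ {Sg : Signature} where

  ∈v-var : ∀ {x y} → _∈v_ {Sg} x (var y) → x ≡ y
  ∈v-var here = refl

  ∈v-[]⁻ : ∀ {x} (t : Term Sg) σ → x ∈v (t [ σ ]) → ∃[ y ] y ∈v t × x ∈v σ y
  ∈v-[]⁻ (var y)   σ x∈       = y , here , x∈
  ∈v-[]⁻ (op o ts) σ (there i x∈) with ∈v-[]⁻ (ts i) σ x∈
  ... | y , y∈ , x∈σy = y , there i y∈ , x∈σy

  ∈v-[]⁺ : ∀ {x y} {t : Term Sg} σ → y ∈v t → x ∈v σ y → x ∈v (t [ σ ])
  ∈v-[]⁺ σ here        x∈ = x∈
  ∈v-[]⁺ σ (there i y∈) x∈ = there i (∈v-[]⁺ σ y∈ x∈)

  ∈v-rename⁺ : ∀ {x} {t : Term Sg} f → x ∈v t → f x ∈v rename t f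
  ∈v-rename⁺ f x∈ = ∈v-[]⁺ _ x∈ here

  ∈v-rename⁻ : ∀ {z} (t : Term Sg) f → z ∈v rename t f → ∃[ x ] x ∈v t × z ≡ f x
  ∈v-rename⁻ t f z∈ with ∈v-[]⁻ t _ z∈
  ... | x , x∈ , z∈fx = x , x∈ , ∈v-var z∈fx

  _∈v?_ : ∀ x (t : Term Sg) → Dec (x ∈v t)
  x ∈v? var y with x ≟ y
  ... | yes refl = yes here
  ... | no  x≢y  = no (x≢y ∘ ∈v-var)
  x ∈v? op o ts with any? (λ i → x ∈v? ts i)
  ... | yes (i , x∈) = yes (there i x∈)
  ... | no  x∉       = no (λ { (there i x∈) → x∉ (i , x∈) })

  const-closed : ∀ o p → Closed (const {Sg} o p)
  const-closed o p x (there i _) with subst Fin p i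
  ... | ()

  ∈v-app2⁻ : ∀ {r a b z} → Binary r → z ∈v app2 {Sg} r a b → z ∈v a ⊎ z ∈v b
  ∈v-app2⁻ {r} {a} {b} r-binary z∈ with ∈v-[]⁻ r (pair a b) z∈
  ... | k , k∈ , z∈k with r-binary k k∈
  ... | inj₁ refl = inj₁ z∈k
  ... | inj₂ refl = inj₂ z∈k

  ∈v-app2⁺ˡ : ∀ {r a b z} → 0 ∈v r → z ∈v a → z ∈v app2 {Sg} r a b
  ∈v-app2⁺ˡ 0∈r z∈a = ∈v-[]⁺ _ 0∈r z∈a

  ∈v-app2⁺ʳ : ∀ {r a b z} → 1 ∈v r → z ∈v b → z ∈v app2 {Sg} r a b
  ∈v-app2⁺ʳ 1∈r z∈b = ∈v-[]⁺ _ 1∈r z∈b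

  _↦_ : ℕ → Term Sg → ℕ → Term Sg
  (x ↦ e) v with v ≟ x
  ... | yes _ = e
  ... | no  _ = var v

  ↦-same : ∀ x e → (x ↦ e) x ≡ e
  ↦-same x e rewrite ≟-diag (refl {x = x}) = refl

  ↦-other : ∀ {x v} e → v ≢ x → (x ↦ e) v ≡ var v
  ↦-other {x} {v} e v≢x with v ≟ x
  ... | yes v≡x = ⊥-elim (v≢x v≡x)
  ... | no  _   = refl

  isolate : Term Sg → ℕ → ℕ → Term Sg
  isolate e = subExcept (λ _ → e)

  isolate-∈v : ∀ {z} {t : Term Sg} e → z ∈v t → z ∈v (t [ isolate e z ])
  isolate-∈v {z} e z∈ = ∈v-[]⁺ _ z∈ (self z)
    where
      self : ∀ z → z ∈v isolate e z z
      self z rewrite ≟-diag (refl {x = z}) = here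

  isolate-closed : ∀ {z} {e} (t : Term Sg) → Closed e → ¬ z ∈v t → Closed (t [ isolate e z ])
  isolate-closed {z} t e-closed z∉t w w∈ with ∈v-[]⁻ t _ w∈
  ... | y , y∈ , w∈y with y ≟ z
  ...   | yes refl = z∉t y∈
  ...   | no  _    = e-closed w w∈y

translate-↦ : ∀ {Sg Sg′} (ι : SigIncl Sg Sg′) x e v → translate ι ((x ↦ e) v) ≡ (x ↦ translate ι e) v
translate-↦ ι x e v with v ≟ x
... | yes _ = refl
... | no  _ = refl

module _ {𝕋 : Theory} where

  infixr 5 _∙_
  _∙_ : ∀ {u v w} → 𝕋 ⊢ u ≈ v → 𝕋 ⊢ v ≈ w → 𝕋 ⊢ u ≈ w
  _∙_ = ≈-trans

  ≡⇒≈ : ∀ {u v} → u ≡ v → 𝕋 ⊢ u ≈ v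
  ≡⇒≈ refl = ≈-refl

  []-cong-∈v : ∀ (t : TTerm 𝕋) {σ τ} → (∀ x → x ∈v t → 𝕋 ⊢ σ x ≈ τ x) → 𝕋 ⊢ (t [ σ ]) ≈ (t [ τ ])
  []-cong-∈v (var x)   σ≈τ = σ≈τ x here
  []-cong-∈v (op o ts) σ≈τ = ≈-cong o (λ i → []-cong-∈v (ts i) (λ x x∈ → σ≈τ x (there i x∈)))

  []-[] : ∀ (t : TTerm 𝕋) σ τ → 𝕋 ⊢ ((t [ σ ]) [ τ ]) ≈ (t [ (λ x → σ x [ τ ]) ])
  []-[] (var x)   σ τ = ≈-refl
  []-[] (op o ts) σ τ = ≈-cong o (λ i → []-[] (ts i) σ τ)

  []-identity : ∀ (t : TTerm 𝕋) → 𝕋 ⊢ (t [ var ]) ≈ t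
  []-identity (var x)   = ≈-refl
  []-identity (op o ts) = ≈-cong o (λ i → []-identity (ts i))

  []-fresh : ∀ (t : TTerm 𝕋) {σ} → (∀ x → x ∈v t → σ x ≡ var x) → 𝕋 ⊢ (t [ σ ]) ≈ t
  []-fresh t σ-fixes = []-cong-∈v t (λ x x∈ → ≡⇒≈ (σ-fixes x x∈)) ∙ []-identity t

  ≈-[] : ∀ {u v} → 𝕋 ⊢ u ≈ v → ∀ τ → 𝕋 ⊢ (u [ τ ]) ≈ (v [ τ ])
  ≈-[] ≈-refl        τ = ≈-refl
  ≈-[] (≈-sym p)     τ = ≈-sym (≈-[] p τ)
  ≈-[] (≈-trans p q) τ = ≈-[] p τ ∙ ≈-[] q τ
  ≈-[] (≈-cong o ps) τ = ≈-cong o (λ i → ≈-[] (ps i) τ)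
  ≈-[] (≈-ax a σ)    τ = []-[] (lhs 𝕋 a) σ τ ∙ ≈-ax a _ ∙ ≈-sym ([]-[] (rhs 𝕋 a) σ τ)

  binary-[]-cong : ∀ {r} → Binary r → ∀ {σ τ} → 𝕋 ⊢ σ 0 ≈ τ 0 → 𝕋 ⊢ σ 1 ≈ τ 1 → 𝕋 ⊢ (r [ σ ]) ≈ (r [ τ ])
  binary-[]-cong {r} r-binary {σ} {τ} σ0≈τ0 σ1≈τ1 = []-cong-∈v r componentwise
    where
      componentwise : ∀ x → x ∈v r → 𝕋 ⊢ σ x ≈ τ x
      componentwise x x∈ with r-binary x x∈
      ... | inj₁ refl = σ0≈τ0
      ... | inj₂ refl = σ1≈τ1

  app2-[] : ∀ {r} → Binary r → ∀ {a b a′ b′} τ →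
            𝕋 ⊢ (a [ τ ]) ≈ a′ → 𝕋 ⊢ (b [ τ ]) ≈ b′ → 𝕋 ⊢ (app2 r a b [ τ ]) ≈ app2 r a′ b′
  app2-[] {r} r-binary {a} {b} τ a≈ b≈ = []-[] r (pair a b) τ ∙ binary-[]-cong r-binary a≈ b≈

  module ClosedStability (closed-stable : ClosedStable 𝕋) {e : TTerm 𝕋} (e-closed : Closed e) where

    -- Substituting e for all variables but z turns v into a closed term if z ∉ v.
    ∈v-≈ : ∀ {u v z} → 𝕋 ⊢ u ≈ v → z ∈v u → z ∈v v
    ∈v-≈ {u} {v} {z} u≈v z∈u with z ∈v? v
    ... | yes z∈v = z∈v
    ... | no  z∉v = ⊥-elim (closed-stable _ _ (isolate-closed v e-closed z∉v)
                              (≈-sym (≈-[] u≈v (isolate e z))) z (isolate-∈v e z∈u))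

    rename-∈v-≈ : ∀ {t t′ f f′} → 𝕋 ⊢ rename t f ≈ rename t′ f′ →
                  ∀ {x} → x ∈v t → ∃[ x′ ] x′ ∈v t′ × f x ≡ f′ x′
    rename-∈v-≈ {t′ = t′} {f′ = f′} eq x∈ = ∈v-rename⁻ t′ f′ (∈v-≈ eq (∈v-rename⁺ _ x∈))

    unit-occursˡ : ∀ {r} → Binary r → 𝕋 ⊢ app2 r (var 0) e ≈ var 0 → 0 ∈v r
    unit-occursˡ {r} r-binary unit with ∈v-[]⁻ r _ (∈v-≈ (≈-sym unit) here)
    ... | k , k∈ , 0∈k with r-binary k k∈
    ... | inj₁ refl = k∈
    ... | inj₂ refl = ⊥-elim (e-closed 0 0∈k)

    unit-occursʳ : ∀ {r} → Binary r → 𝕋 ⊢ app2 r e (var 1) ≈ var 1 → 1 ∈v r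
    unit-occursʳ {r} r-binary unit with ∈v-[]⁻ r _ (∈v-≈ (≈-sym unit) here)
    ... | k , k∈ , 1∈k with r-binary k k∈
    ... | inj₁ refl = ⊥-elim (e-closed 1 1∈k)
    ... | inj₂ refl = k∈

module Translation {X 𝕌 : Theory} (ι : SigIncl (sig X) (sig 𝕌))
  (preserves-axioms : ∀ a → 𝕌 ⊢ translate ι (lhs X a) ≈ translate ι (rhs X a)) where

  private
    tr : TTerm X → TTerm 𝕌
    tr = translate ι

  translate-[] : ∀ (t : TTerm X) σ → 𝕌 ⊢ tr (t [ σ ]) ≈ (tr t [ tr ∘ σ ])
  translate-[] (var x)   σ = ≈-refl
  translate-[] (op o ts) σ = ≈-cong (map ι o) (λ i → translate-[] (ts (subst Fin (pres ι o) i)) σ)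

  translate-[↦] : ∀ (t : TTerm X) x e → 𝕌 ⊢ tr (t [ x ↦ e ]) ≈ (tr t [ x ↦ tr e ])
  translate-[↦] t x e = translate-[] t (x ↦ e) ∙ []-cong-∈v (tr t) (λ v _ → ≡⇒≈ (translate-↦ ι x e v))

  ∈v-translate : ∀ {x} (t : TTerm X) → x ∈v tr t → x ∈v t
  ∈v-translate (var y)   here        = here
  ∈v-translate (op o ts) (there i x∈) = there (subst Fin (pres ι o) i) (∈v-translate _ x∈)

  translate-closed : ∀ {t} → Closed t → Closed (tr t)
  translate-closed {t} t-closed x x∈ = t-closed x (∈v-translate t x∈)

  translate-binary : ∀ {r} → Binary r → Binary (tr r)
  translate-binary {r} r-binary x x∈ = r-binary x (∈v-translate r x∈)

  translate-≈ : ∀ {a b} → X ⊢ a ≈ b → 𝕌 ⊢ tr a ≈ tr b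
  translate-≈ ≈-refl        = ≈-refl
  translate-≈ (≈-sym p)     = ≈-sym (translate-≈ p)
  translate-≈ (≈-trans p q) = translate-≈ p ∙ translate-≈ q
  translate-≈ (≈-cong o ps) = ≈-cong (map ι o) (λ i → translate-≈ (ps (subst Fin (pres ι o) i)))
  translate-≈ (≈-ax a σ)    =
    translate-[] (lhs X a) σ ∙ ≈-[] (preserves-axioms a) (tr ∘ σ) ∙ ≈-sym (translate-[] (rhs X a) σ)

  translate-app2 : ∀ {r} → Binary r → ∀ a b → 𝕌 ⊢ tr (app2 r a b) ≈ app2 (tr r) (tr a) (tr b)
  translate-app2 {r} r-binary a b =
    translate-[] r (pair a b) ∙ binary-[]-cong (translate-binary r-binary) ≈-refl ≈-refl

  translate-unitʳ : ∀ {r e} → Binary r → Closed e → X ⊢ app2 r (var 0) e ≈ var 0 →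
                    ∀ a → 𝕌 ⊢ app2 (tr r) a (tr e) ≈ a
  translate-unitʳ {r} {e} r-binary e-closed unit a =
    ≈-sym (app2-[] (translate-binary r-binary) (λ _ → a) ≈-refl ([]-fresh (tr e) e-fixed))
    ∙ ≈-[] (≈-sym (translate-app2 r-binary (var 0) e) ∙ translate-≈ unit) (λ _ → a)
    where
      e-fixed : ∀ x → x ∈v tr e → a ≡ var x
      e-fixed x x∈ = ⊥-elim (translate-closed e-closed x x∈)

  translate-unitˡ : ∀ {r e} → Binary r → Closed e → X ⊢ app2 r e (var 1) ≈ var 1 →
                    ∀ a → 𝕌 ⊢ app2 (tr r) (tr e) a ≈ a
  translate-unitˡ {r} {e} r-binary e-closed unit a =
    ≈-sym (app2-[] (translate-binary r-binary) (λ _ → a) ([]-fresh (tr e) e-fixed) ≈-refl)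
    ∙ ≈-[] (≈-sym (translate-app2 r-binary e (var 1)) ∙ translate-≈ unit) (λ _ → a)
    where
      e-fixed : ∀ x → x ∈v tr e → a ≡ var x
      e-fixed x x∈ = ⊥-elim (translate-closed e-closed x x∈)

  translate-app2-↦ʳ : ∀ {r e} → Binary r → Closed e → X ⊢ app2 r (var 0) e ≈ var 0 →
                      ∀ {y₁ y₂} → y₁ ≢ y₂ → 𝕌 ⊢ (tr (app2 r (var y₁) (var y₂)) [ y₂ ↦ tr e ]) ≈ var y₁
  translate-app2-↦ʳ r-binary e-closed unit {y₁} {y₂} y₁≢y₂ =
    ≈-[] (translate-app2 r-binary _ _) _
    ∙ app2-[] (translate-binary r-binary) _ (≡⇒≈ (↦-other _ y₁≢y₂)) (≡⇒≈ (↦-same y₂ _))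
    ∙ translate-unitʳ r-binary e-closed unit (var y₁)

  translate-app2-↦ˡ : ∀ {r e} → Binary r → Closed e → X ⊢ app2 r e (var 1) ≈ var 1 →
                      ∀ {y₁ y₂} → y₁ ≢ y₂ → 𝕌 ⊢ (tr (app2 r (var y₁) (var y₂)) [ y₁ ↦ tr e ]) ≈ var y₂
  translate-app2-↦ˡ r-binary e-closed unit {y₁} {y₂} y₁≢y₂ =
    ≈-[] (translate-app2 r-binary _ _) _
    ∙ app2-[] (translate-binary r-binary) _ (≡⇒≈ (↦-same y₁ _)) (≡⇒≈ (↦-other _ (y₁≢y₂ ∘ sym)))
    ∙ translate-unitˡ r-binary e-closed unit (var y₂)

module Composition {𝕊 𝕋 𝕌 : Theory} (c : Contains 𝕊 𝕋 𝕌) where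

  module S = Translation (ιS c) (eqsS c)
  module T = Translation (ιT c) (eqsT c)

  trS : TTerm 𝕊 → TTerm 𝕌
  trS = translate (ιS c)

  trT : TTerm 𝕋 → TTerm 𝕌
  trT = translate (ιT c)

  Separation : TTerm 𝕌 → Set
  Separation u = Σ[ t ∈ TTerm 𝕋 ] Σ[ s ∈ (ℕ → TTerm 𝕊) ] 𝕌 ⊢ u ≈ sep c t s

  graft : TTerm 𝕋 → (ℕ → TTerm 𝕋) → TTerm 𝕋
  graft t T = t [ (λ n → rename (T n) ⟨ n ,_⟩) ]

  gather : (ℕ → ℕ → TTerm 𝕊) → ℕ → TTerm 𝕊
  gather R m = R (proj₁ (unpair m)) (proj₂ (unpair m))

  sep-graft : ∀ t T R → 𝕌 ⊢ sep c (graft t T) (gather R) ≈ (trT t [ (λ n → sep c (T n) (R n)) ])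
  sep-graft t T R =
    ≈-[] (T.translate-[] t _) _ ∙ []-[] (trT t) _ _ ∙ []-cong-∈v (trT t) (λ n _ → grafted n)
    where
      grafted : ∀ n → 𝕌 ⊢ (trT (rename (T n) ⟨ n ,_⟩) [ trS ∘ gather R ]) ≈ sep c (T n) (R n)
      grafted n =
        ≈-[] (T.translate-[] (T n) _) _ ∙ []-[] (trT (T n)) _ _
        ∙ []-cong-∈v (trT (T n)) (λ v _ → ≡⇒≈ (cong (λ (m , v′) → trS (R m v′)) (unpair-⟨,⟩ n v)))

  module _ (composite : IsComposite c) where

    separate : ∀ u → Separation u
    separate = proj₁ composite

    -- Fill the x-th hole by the trivial separation of w x and all other holes
    -- arbitrarily; uniqueness of separations then compares that filler with C.
    filler-≈ : VarStable 𝕋 → ∀ t (w : ℕ → TTerm 𝕌) {C} → 𝕌 ⊢ (trT t [ w ]) ≈ trS C →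
               ∀ {x} → x ∈v t → ∀ {r} → 𝕌 ⊢ w x ≈ trS r → 𝕊 ⊢ r ≈ C
    filler-≈ var-stable t w {C} t[w]≈C {x} x∈t {r} wx≈r =
      compare (proj₂ composite (graft t T) (gather R) (var 0) (λ _ → C) (trS C) grafted ≈-refl)
      where
        choice : ∀ n → Separation (w n)
        choice n with n ≟ x
        ... | yes refl = var 0 , (λ _ → r) , wx≈r
        ... | no  _    = separate (w n)

        T : ℕ → TTerm 𝕋
        T n = proj₁ (choice n)
        R : ℕ → ℕ → TTerm 𝕊
        R n = proj₁ (proj₂ (choice n))

        choice-x : choice x ≡ (var 0 , (λ _ → r) , wx≈r)
        choice-x rewrite ≟-diag (refl {x = x}) = refl

        grafted : 𝕌 ⊢ sep c (graft t T) (gather R) ≈ trS C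
        grafted = sep-graft t T R ∙ ≈-sym ([]-cong-∈v (trT t) (λ n _ → proj₂ (proj₂ (choice n)))) ∙ t[w]≈C

        gather-x : gather R ⟨ x , 0 ⟩ ≡ r
        gather-x rewrite unpair-⟨,⟩ x 0 | choice-x = refl

        x-hole : ⟨ x , 0 ⟩ ∈v graft t T
        x-hole = ∈v-[]⁺ _ x∈t (subst (λ T′ → ⟨ x , 0 ⟩ ∈v rename T′ ⟨ x ,_⟩) (sym (cong proj₁ choice-x)) here)

        compare : EqMod c (graft t T) (gather R) (var 0) (λ _ → C) → 𝕊 ⊢ r ≈ C
        compare (g , g′ , sb , t″≈g′0 , gathered≈ , C≈) =
          ≡⇒≈ (sym gather-x) ∙ gathered≈ _ x-hole ∙ ≡⇒≈ (cong sb x-hole↦g′0) ∙ ≈-sym (C≈ 0 here)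
          where
            x-hole↦g′0 : g ⟨ x , 0 ⟩ ≡ g′ 0
            x-hole↦g′0 = var-stable _ (g′ 0) t″≈g′0 _ (∈v-rename⁺ g x-hole)

    module _ (S-var-stable : VarStable 𝕊) (T-closed-stable : ClosedStable 𝕋) (T-var-stable : VarStable 𝕋)
             {e : TTerm 𝕋} (e-closed : Closed e) where

      open ClosedStability T-closed-stable e-closed

      variable-fillers : ∀ {t σ T₀} → 𝕌 ⊢ sep c t σ ≈ trT T₀ →
          (∀ {x} → x ∈v t → ∃[ y ] y ∈v T₀ × 𝕊 ⊢ σ x ≈ var y)
        × (∀ {y} → y ∈v T₀ → ∃[ x ] x ∈v t × 𝕊 ⊢ σ x ≈ var y)
      variable-fillers {t} {σ} {T₀} eq with proj₂ composite t σ T₀ var (trT T₀) eq ([]-identity (trT T₀))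
      ... | f , f′ , sb , tf≈T₀f′ , σ≈ , var≈ = forward , backward
        where
          forward : ∀ {x} → x ∈v t → ∃[ y ] y ∈v T₀ × 𝕊 ⊢ σ x ≈ var y
          forward x∈ with rename-∈v-≈ tf≈T₀f′ x∈
          ... | y , y∈ , fx≡f′y = y , y∈ , σ≈ _ x∈ ∙ ≡⇒≈ (cong sb fx≡f′y) ∙ ≈-sym (var≈ y y∈)

          backward : ∀ {y} → y ∈v T₀ → ∃[ x ] x ∈v t × 𝕊 ⊢ σ x ≈ var y
          backward y∈ with rename-∈v-≈ (≈-sym tf≈T₀f′) y∈
          ... | x , x∈ , f′y≡fx = x , x∈ , σ≈ x x∈ ∙ ≡⇒≈ (cong sb (sym f′y≡fx)) ∙ ≈-sym (var≈ _ y∈)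

      ∉-specialisation : ∀ {r x₀ e₀ y z} → 𝕊 ⊢ (r [ x₀ ↦ e₀ ]) ≈ var y → z ≢ y → z ≢ x₀ → ¬ z ∈v r
      ∉-specialisation r≈y z≢y z≢x₀ z∈r =
        z≢y (S-var-stable _ _ r≈y _ (∈v-[]⁺ _ z∈r (subst (_ ∈v_) (sym (↦-other _ z≢x₀)) here)))

      filler-of-specialisation : ∀ {u t σ z e₁ C} → 𝕌 ⊢ u ≈ sep c t σ → 𝕌 ⊢ (u [ z ↦ e₁ ]) ≈ trS C →
                                 ∀ {x} → x ∈v t → ¬ z ∈v σ x → 𝕊 ⊢ σ x ≈ C
      filler-of-specialisation {t = t} {σ} {z} {e₁} u≈ u[z↦e₁]≈C {x} x∈ z∉σx =
        filler-≈ T-var-stable t (λ n → trS (σ n) [ z ↦ e₁ ])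
          (≈-sym ([]-[] (trT t) _ _) ∙ ≈-[] (≈-sym u≈) _ ∙ u[z↦e₁]≈C) x∈
          ([]-fresh (trS (σ x)) (λ v v∈ → ↦-other e₁ (λ { refl → z∉σx (S.∈v-translate (σ x) v∈) })))

      splits : ∀ {u T₀ x₀ y₁ y₂ e₀ e₁ e₂ A B} → y₁ ≢ y₂ → y₁ ≢ x₀ → y₂ ≢ x₀ →
               (∀ {y} → y ∈v T₀ → y ≡ y₁ ⊎ y ≡ y₂) → y₁ ∈v T₀ → y₂ ∈v T₀ →
               𝕌 ⊢ (u [ x₀ ↦ trS e₀ ]) ≈ trT T₀ →
               𝕌 ⊢ (u [ y₂ ↦ e₂ ]) ≈ trS A →
               𝕌 ⊢ (u [ y₁ ↦ e₁ ]) ≈ trS B →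
               SplitsAs c u A B
      splits {u} {T₀} {x₀} {y₁} {y₂} {e₀} {A = A} {B} y₁≢y₂ y₁≢x₀ y₂≢x₀ T₀-vars y₁∈ y₂∈
             u[x₀]≈T₀ u[y₂]≈A u[y₁]≈B with separate u
      ... | t , σ , u≈ = t , σ , u≈ , each , exists-A , exists-B
        where
          specialised : 𝕌 ⊢ sep c t (λ x → σ x [ x₀ ↦ e₀ ]) ≈ trT T₀
          specialised =
            []-cong-∈v (trT t) (λ n _ → S.translate-[↦] (σ n) x₀ e₀) ∙ ≈-sym ([]-[] (trT t) _ _)
            ∙ ≈-[] (≈-sym u≈) _ ∙ u[x₀]≈T₀

          is-A : ∀ {x} → x ∈v t → 𝕊 ⊢ (σ x [ x₀ ↦ e₀ ]) ≈ var y₁ → 𝕊 ⊢ σ x ≈ A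
          is-A x∈ σx≈y₁ = filler-of-specialisation u≈ u[y₂]≈A x∈
                            (∉-specialisation σx≈y₁ (y₁≢y₂ ∘ sym) y₂≢x₀)

          is-B : ∀ {x} → x ∈v t → 𝕊 ⊢ (σ x [ x₀ ↦ e₀ ]) ≈ var y₂ → 𝕊 ⊢ σ x ≈ B
          is-B x∈ σx≈y₂ = filler-of-specialisation u≈ u[y₁]≈B x∈
                            (∉-specialisation σx≈y₂ y₁≢y₂ y₁≢x₀)

          each : ∀ x → x ∈v t → (𝕊 ⊢ σ x ≈ A) ⊎ (𝕊 ⊢ σ x ≈ B)
          each x x∈ with proj₁ (variable-fillers specialised) x∈
          ... | y , y∈ , σx≈y with T₀-vars y∈
          ...   | inj₁ refl = inj₁ (is-A x∈ σx≈y)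
          ...   | inj₂ refl = inj₂ (is-B x∈ σx≈y)

          exists-A : Σ[ x ∈ ℕ ] (x ∈v t) × (𝕊 ⊢ σ x ≈ A)
          exists-A with proj₂ (variable-fillers specialised) y₁∈
          ... | x , x∈ , σx≈y₁ = x , x∈ , is-A x∈ σx≈y₁

          exists-B : Σ[ x ∈ ℕ ] (x ∈v t) × (𝕊 ⊢ σ x ≈ B)
          exists-B with proj₂ (variable-fillers specialised) y₂∈
          ... | x , x∈ , σx≈y₂ = x , x∈ , is-B x∈ σx≈y₂

      splits-app2 : ∀ {s e₀ T₀ x₀ y₁ y₂ e₁} → Binary s → Closed e₀ →
          𝕊 ⊢ app2 s (var 0) e₀ ≈ var 0 → 𝕊 ⊢ app2 s e₀ (var 1) ≈ var 1 →
          y₁ ≢ y₂ → y₁ ≢ x₀ → y₂ ≢ x₀ →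
          (∀ {y} → y ∈v T₀ → y ≡ y₁ ⊎ y ≡ y₂) → y₁ ∈v T₀ → y₂ ∈v T₀ →
          𝕌 ⊢ (trT T₀ [ y₂ ↦ e₁ ]) ≈ var y₁ → 𝕌 ⊢ (trT T₀ [ y₁ ↦ e₁ ]) ≈ var y₂ →
          SplitsAs c (app2 (trS s) (trT T₀) (var x₀)) (app2 s (var y₁) (var x₀)) (app2 s (var y₂) (var x₀))
        × SplitsAs c (app2 (trS s) (var x₀) (trT T₀)) (app2 s (var x₀) (var y₁)) (app2 s (var x₀) (var y₂))
      splits-app2 {s} {e₀} {T₀} {x₀} {y₁} {y₂} {e₁} s-binary e₀-closed unitʳ unitˡ y₁≢y₂ y₁≢x₀ y₂≢x₀
                  T₀-vars y₁∈ y₂∈ T₀[y₂]≈y₁ T₀[y₁]≈y₂ =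
          split (app2-[] s-binary′ _ T₀-fresh x₀↦e₀ ∙ S.translate-unitʳ s-binary e₀-closed unitʳ _)
                (app2-[] s-binary′ _ T₀[y₂]≈y₁ (x₀-fixed y₂≢x₀) ∙ s-app (var y₁) (var x₀))
                (app2-[] s-binary′ _ T₀[y₁]≈y₂ (x₀-fixed y₁≢x₀) ∙ s-app (var y₂) (var x₀))
        , split (app2-[] s-binary′ _ x₀↦e₀ T₀-fresh ∙ S.translate-unitˡ s-binary e₀-closed unitˡ _)
                (app2-[] s-binary′ _ (x₀-fixed y₂≢x₀) T₀[y₂]≈y₁ ∙ s-app (var x₀) (var y₁))
                (app2-[] s-binary′ _ (x₀-fixed y₁≢x₀) T₀[y₁]≈y₂ ∙ s-app (var x₀) (var y₂))
        where
          split : ∀ {u A B} → 𝕌 ⊢ (u [ x₀ ↦ trS e₀ ]) ≈ trT T₀ →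
                  𝕌 ⊢ (u [ y₂ ↦ e₁ ]) ≈ trS A → 𝕌 ⊢ (u [ y₁ ↦ e₁ ]) ≈ trS B → SplitsAs c u A B
          split = splits {e₀ = e₀} y₁≢y₂ y₁≢x₀ y₂≢x₀ T₀-vars y₁∈ y₂∈

          s-binary′ : Binary (trS s)
          s-binary′ = S.translate-binary s-binary

          s-app : ∀ a b → 𝕌 ⊢ app2 (trS s) (trS a) (trS b) ≈ trS (app2 s a b)
          s-app a b = ≈-sym (S.translate-app2 s-binary a b)

          x₀↦e₀ : 𝕌 ⊢ (var x₀ [ x₀ ↦ trS e₀ ]) ≈ trS e₀
          x₀↦e₀ = ≡⇒≈ (↦-same x₀ _)

          x₀-fixed : ∀ {y e} → y ≢ x₀ → 𝕌 ⊢ (var x₀ [ y ↦ e ]) ≈ var x₀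
          x₀-fixed y≢x₀ = ≡⇒≈ (↦-other _ (y≢x₀ ∘ sym))

          y≢x₀ : ∀ {y} → y ≡ y₁ ⊎ y ≡ y₂ → y ≢ x₀
          y≢x₀ (inj₁ refl) = y₁≢x₀
          y≢x₀ (inj₂ refl) = y₂≢x₀

          T₀-fresh : 𝕌 ⊢ (trT T₀ [ x₀ ↦ trS e₀ ]) ≈ trT T₀
          T₀-fresh = []-fresh (trT T₀) (λ y y∈ → ↦-other _ (y≢x₀ (T₀-vars (T.∈v-translate T₀ y∈))))

lemma4p12 : (𝕊 𝕋 : Theory)
    → ClosedStable 𝕊 → VarStable 𝕊 → VarRecover 𝕊
    → ClosedStable 𝕋 → VarStable 𝕋 → HasConstant 𝕋
    → (s : TTerm 𝕊) → Binary s → HasUnit 𝕊 s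
    → (t : TTerm 𝕋) → Binary t → HasUnit 𝕋 t
    → (𝕌 : Theory) → (c : Contains 𝕊 𝕋 𝕌) → IsComposite c
    → (y₁ y₂ x₀ : ℕ) → y₁ ≢ y₂ → y₁ ≢ x₀ → y₂ ≢ x₀
    → SplitsAs c
        (app2 (translate (ιS c) s) (translate (ιT c) (app2 t (var y₁) (var y₂))) (var x₀))
        (app2 s (var y₁) (var x₀)) (app2 s (var y₂) (var x₀))
      × SplitsAs c
        (app2 (translate (ιS c) s) (var x₀) (translate (ιT c) (app2 t (var y₁) (var y₂))))
        (app2 s (var x₀) (var y₁)) (app2 s (var x₀) (var y₂))
lemma4p12 𝕊 𝕋 _ S-var-stable _ T-closed-stable T-var-stable _ s s-binary (oₛ , pₛ , unitₛ)
          t t-binary (oₜ , pₜ , unitₜ) 𝕌 c composite y₁ y₂ x₀ y₁≢y₂ y₁≢x₀ y₂≢x₀ =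
  splits-app2 composite S-var-stable T-closed-stable T-var-stable eₜ-closed
    s-binary (const-closed oₛ pₛ) (proj₁ (unitₛ 0)) (proj₂ (unitₛ 1)) y₁≢y₂ y₁≢x₀ y₂≢x₀
    T₀-vars
    (∈v-app2⁺ˡ (unit-occursˡ t-binary (proj₁ (unitₜ 0))) here)
    (∈v-app2⁺ʳ (unit-occursʳ t-binary (proj₂ (unitₜ 1))) here)
    (T.translate-app2-↦ʳ t-binary eₜ-closed (proj₁ (unitₜ 0)) y₁≢y₂)
    (T.translate-app2-↦ˡ t-binary eₜ-closed (proj₂ (unitₜ 1)) y₁≢y₂)
  where
    open Composition c

    eₜ-closed : Closed (const oₜ pₜ)
    eₜ-closed = const-closed oₜ pₜ

    open ClosedStability T-closed-stable eₜ-closed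

    T₀-vars : ∀ {y} → y ∈v app2 t (var y₁) (var y₂) → y ≡ y₁ ⊎ y ≡ y₂
    T₀-vars y∈ with ∈v-app2⁻ t-binary y∈
    ... | inj₁ here = inj₁ refl
    ... | inj₂ here = inj₂ refl
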